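{- Let $\mathcal{A},\mathcal{B}$ be weighted families of $(r,k)$-sets, and let $\mathcal{A}'\subseteq\mathcal{A}$ represent $\mathcal{A}$ and $\mathcal{B}'\subseteq\mathcal{B}$ represent $\mathcal{B}$. Then $\mathcal{A}'\bullet\mathcal{B}'$ represents $\mathcal{A}\bullet\mathcal{B}$.
   Context: An \emph{$(r,k)$-set} is a vector $A\in\{0,\ldots,r\}^n$ (a multiset over $[n]$) with $|A|=\sum_iA_i\le k$. $(A+B)_i=A_i+B_i$. $(r,k)$-sets $A,B$ are \emph{$(r,k)$-compatible} if $A_i+B_i\le r$ for all $i$ and $|A+B|=k$; they are \emph{$(r,k)$-consistent} if $A_i+B_i\le r$ for all $i$ and $|A+B|\le k$. For families $\mathcal{A},\mathcal{B}$, $\mathcal{A}\bullet\mathcal{B}=\{A+B: A\in\mathcal{A},B\in\mathcal{B}, A,B\text{ are }(r,k)\text{ -consistent}\}$. The universe $[n]$ carries a weight function $\mathrm{wt}$, and $\mathrm{wt}(A)=\sum_iA_i\,\mathrm{wt}(i)$. A subfamily $\mathcal{P}'\subseteq\mathcal{P}$ \emph{represents} $\mathcal{P}$ if for every $(r,k)$-set $Q$: whenever some $P\in\mathcal{P}$ of weight $w$ is $(r,k)$-compatible with $Q$, some $P'\in\mathcal{P}'$ of weight at most $w$ is $(r,k)$-compatible with $Q$. -}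

module Defs where

open import Data.Nat using (ℕ; zero; _+_; _≤_)
import Data.Nat as ℕ
open import Data.Fin using (Fin; zero; suc)
open import Data.Integer as ℤ using (ℤ; +_)
open import Data.Product using (Σ; ∃; _×_; _,_)
open import Relation.Binary.PropositionalEquality using (_≡_)
open import Level using (Level; _⊔_)

-- A multiset over [n] = Fin n, given by multiplicities.
MSet : ℕ → Set
MSet n = Fin n → ℕ

size : ∀ {n} → MSet n → ℕ
size {zero}  A = 0
size {ℕ.suc n} A = A zero + size (λ i → A (suc i))

weight : ∀ {n} → (Fin n → ℤ) → MSet n → ℤ
weight {zero}  w A = + 0
weight {ℕ.suc n} w A = (+ A zero) ℤ.* w zero ℤ.+ weight (λ i → w (suc i)) (λ i → A (suc i))

_⊕_ : ∀ {n} → MSet n → MSet n → MSet n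
(A ⊕ B) i = A i + B i

IsRKSet : ∀ {n} → ℕ → ℕ → MSet n → Set
IsRKSet r k A = (∀ i → A i ≤ r) × size A ≤ k

Compatible : ∀ {n} → ℕ → ℕ → MSet n → MSet n → Set
Compatible r k A B = (∀ i → A i + B i ≤ r) × size (A ⊕ B) ≡ k

Consistent : ∀ {n} → ℕ → ℕ → MSet n → MSet n → Set
Consistent r k A B = (∀ i → A i + B i ≤ r) × size (A ⊕ B) ≤ k

-- A family of multisets over [n], as a predicate (membership).
Family : ∀ ℓ → ℕ → Set (Level.suc ℓ)
Family ℓ n = MSet n → Set ℓ

FamilyOfRKSets : ∀ {ℓ n} → ℕ → ℕ → Family ℓ n → Set ℓ
FamilyOfRKSets r k 𝒜 = ∀ A → 𝒜 A → IsRKSet r k A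

_⊆F_ : ∀ {ℓ ℓ' n} → Family ℓ n → Family ℓ' n → Set (ℓ ⊔ ℓ')
𝒜' ⊆F 𝒜 = ∀ A → 𝒜' A → 𝒜 A

-- 𝒜 • ℬ = { A + B : A ∈ 𝒜, B ∈ ℬ, A,B (r,k)-consistent }
-- (membership of P: P is pointwise equal to such an A + B)
bullet : ∀ {ℓ ℓ' n} → ℕ → ℕ → Family ℓ n → Family ℓ' n → Family (ℓ ⊔ ℓ') n
bullet r k 𝒜 ℬ P =
  Σ _ λ A → Σ _ λ B → 𝒜 A × ℬ B × Consistent r k A B × (∀ i → P i ≡ A i + B i)

Represents : ∀ {ℓ ℓ' n} → ℕ → ℕ → (Fin n → ℤ) → Family ℓ' n → Family ℓ n → Set _
Represents r k w 𝒫' 𝒫 =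
  ∀ Q → IsRKSet r k Q →
  ∀ P → 𝒫 P → Compatible r k P Q →
  Σ _ λ P' → 𝒫' P' × weight w P' ℤ.≤ weight w P × Compatible r k P' Q

module Submission where

-- Whether two multisets are (r,k)-compatible depends only on
-- their pointwise sum, so compatibility of P = A + B with Q can be read as
-- compatibility of A with B + Q.  The set B + Q is itself an (r,k)-set
-- (being part of a compatible pair), so the representative family 𝒜' supplies
-- some A' of weight at most wt(A) compatible with B + Q, i.e. A' + B is
-- compatible with Q.  Doing the same for the second summand replaces B by
-- some B' ∈ ℬ', and A' + B' lies in 𝒜' • ℬ' because the two summands of a
-- compatible sum are consistent.  Weight is additive, so
-- wt(A' + B') ≤ wt(A + B) = wt(P).

open import Defs
open import Data.Nat using (ℕ; zero; suc; _+_; _≤_)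
open import Data.Nat.Properties using (+-mono-≤; ≤-trans; ≤-refl; ≤-reflexive; m≤m+n; +-assoc; +-comm)
open import Data.Fin using (Fin)
import Data.Fin as Fin
open import Data.Integer using (ℤ; +_)
import Data.Integer as ℤ
import Data.Integer.Properties as ℤP
open import Algebra.Properties.CommutativeSemigroup ℤP.+-commutativeSemigroup using (interchange)
open import Data.Product using (Σ; _×_; _,_)
open import Relation.Binary.PropositionalEquality using (_≡_; refl; sym; trans; cong; cong₂; subst; module ≡-Reasoning)

_≋_ : ∀ {n} → MSet n → MSet n → Set
A ≋ B = ∀ i → A i ≡ B i

tail : ∀ {n} {X : Set} → (Fin (suc n) → X) → Fin n → X
tail A i = A (Fin.suc i)

size-resp : ∀ {n} {A B : MSet n} → A ≋ B → size A ≡ size B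
size-resp {zero}  e = refl
size-resp {suc n} e = cong₂ _+_ (e Fin.zero) (size-resp (λ i → e (Fin.suc i)))

weight-resp : ∀ {n} (w : Fin n → ℤ) {A B : MSet n} → A ≋ B → weight w A ≡ weight w B
weight-resp {zero}  w e = refl
weight-resp {suc n} w e =
  cong₂ (λ a b → (+ a) ℤ.* w Fin.zero ℤ.+ b) (e Fin.zero) (weight-resp (tail w) (λ i → e (Fin.suc i)))

size-mono : ∀ {n} {A B : MSet n} → (∀ i → A i ≤ B i) → size A ≤ size B
size-mono {zero}  le = ≤-refl
size-mono {suc n} le = +-mono-≤ (le Fin.zero) (size-mono (λ i → le (Fin.suc i)))

weight-⊕ : ∀ {n} (w : Fin n → ℤ) (A B : MSet n) →
           weight w (A ⊕ B) ≡ weight w A ℤ.+ weight w B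
weight-⊕ {zero}  w A B = refl
weight-⊕ {suc n} w A B = begin
  (+ (a + b)) ℤ.* w₀ ℤ.+ weight (tail w) (tail A ⊕ tail B)
    ≡⟨ cong₂ ℤ._+_ head-distrib (weight-⊕ (tail w) (tail A) (tail B)) ⟩
  ((+ a) ℤ.* w₀ ℤ.+ (+ b) ℤ.* w₀) ℤ.+ (weight (tail w) (tail A) ℤ.+ weight (tail w) (tail B))
    ≡⟨ interchange ((+ a) ℤ.* w₀) ((+ b) ℤ.* w₀) (weight (tail w) (tail A)) (weight (tail w) (tail B)) ⟩
  weight w A ℤ.+ weight w B ∎
  where
  open ≡-Reasoning
  a = A Fin.zero
  b = B Fin.zero
  w₀ = w Fin.zero
  head-distrib : (+ (a + b)) ℤ.* w₀ ≡ (+ a) ℤ.* w₀ ℤ.+ (+ b) ℤ.* w₀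
  head-distrib = trans (cong (ℤ._* w₀) (ℤP.pos-+ a b)) (ℤP.*-distribʳ-+ w₀ (+ a) (+ b))

weight-⊕-mono : ∀ {n} (w : Fin n → ℤ) {A A' B B' : MSet n} →
                weight w A' ℤ.≤ weight w A → weight w B' ℤ.≤ weight w B →
                weight w (A' ⊕ B') ℤ.≤ weight w (A ⊕ B)
weight-⊕-mono w {A} {A'} {B} {B'} A'≤A B'≤B = begin
  weight w (A' ⊕ B')          ≡⟨ weight-⊕ w A' B' ⟩
  weight w A' ℤ.+ weight w B' ≤⟨ ℤP.+-mono-≤ A'≤A B'≤B ⟩
  weight w A ℤ.+ weight w B   ≡⟨ weight-⊕ w A B ⟨
  weight w (A ⊕ B)            ∎
  where open ℤP.≤-Reasoning

compatible-resp : ∀ {n r k} (A B C D : MSet n) →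
                  Compatible r k A B → (A ⊕ B) ≋ (C ⊕ D) → Compatible r k C D
compatible-resp {r = r} A B C D (bounded , sized) e =
  (λ i → subst (_≤ r) (e i) (bounded i)) ,
  trans (size-resp {A = C ⊕ D} {A ⊕ B} (λ i → sym (e i))) sized

compatible-congˡ : ∀ {n r k} (P P' Q : MSet n) →
                   Compatible r k P Q → P ≋ P' → Compatible r k P' Q
compatible-congˡ P P' Q c e = compatible-resp P Q P' Q c (λ i → cong (_+ Q i) (e i))

compatible-sym : ∀ {n r k} (A B : MSet n) → Compatible r k A B → Compatible r k B A
compatible-sym A B c = compatible-resp A B B A c (λ i → +-comm (A i) (B i))

compatible⇒rkSetˡ : ∀ {n r k} (A B : MSet n) → Compatible r k A B → IsRKSet r k A
compatible⇒rkSetˡ A B (bounded , sized) =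
  (λ i → ≤-trans (m≤m+n (A i) (B i)) (bounded i)) ,
  ≤-trans (size-mono {A = A} {A ⊕ B} (λ i → m≤m+n (A i) (B i))) (≤-reflexive sized)

compatible⇒rkSetʳ : ∀ {n r k} (A B : MSet n) → Compatible r k A B → IsRKSet r k B
compatible⇒rkSetʳ A B c = compatible⇒rkSetˡ B A (compatible-sym A B c)

-- If A + B is compatible with some Q, then A and B are consistent
-- (consistency of A, B says exactly that A + B is an (r,k)-set).
compatible⇒consistent : ∀ {n r k} (A B Q : MSet n) →
                        Compatible r k (A ⊕ B) Q → Consistent r k A B
compatible⇒consistent A B Q = compatible⇒rkSetˡ (A ⊕ B) Q

replace-summand : ∀ {ℓ n r k} (w : Fin n → ℤ) {𝒜 𝒜' : Family ℓ n} →
                  Represents r k w 𝒜' 𝒜 →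
                  ∀ {A} B Q → 𝒜 A → Compatible r k (A ⊕ B) Q →
                  Σ (MSet n) λ A' → 𝒜' A' × weight w A' ℤ.≤ weight w A ×
                                    Compatible r k (A' ⊕ B) Q
replace-summand {r = r} {k} w rep {A} B Q A∈𝒜 c
  with rep (B ⊕ Q) (compatible⇒rkSetʳ A (B ⊕ Q) A-compat) A A∈𝒜 A-compat
  where
  A-compat : Compatible r k A (B ⊕ Q)
  A-compat = compatible-resp (A ⊕ B) Q A (B ⊕ Q) c (λ i → +-assoc (A i) (B i) (Q i))
... | A' , A'∈𝒜' , lighter , A'-compat =
  A' , A'∈𝒜' , lighter ,
  compatible-resp A' (B ⊕ Q) (A' ⊕ B) Q A'-compat (λ i → sym (+-assoc (A' i) (B i) (Q i)))

lemma5p5 : ∀ {ℓ} (n r k : ℕ) (w : Fin n → ℤ)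
    (𝒜 𝒜' ℬ ℬ' : Family ℓ n) →
    FamilyOfRKSets r k 𝒜 → FamilyOfRKSets r k ℬ →
    𝒜' ⊆F 𝒜 → ℬ' ⊆F ℬ →
    Represents r k w 𝒜' 𝒜 → Represents r k w ℬ' ℬ →
    Represents r k w (bullet r k 𝒜' ℬ') (bullet r k 𝒜 ℬ)
lemma5p5 n r k w 𝒜 𝒜' ℬ ℬ' _ _ _ _ repA repB Q _ P (A , B , A∈𝒜 , B∈ℬ , _ , P≋A⊕B) PQ-compat
  with replace-summand w repA B Q A∈𝒜 (compatible-congˡ P (A ⊕ B) Q PQ-compat P≋A⊕B)
... | A' , A'∈𝒜' , A'-lighter , A'B-compat
  with replace-summand w repB A' Q B∈ℬ (compatible-congˡ (A' ⊕ B) (B ⊕ A') Q A'B-compat λ i → +-comm (A' i) (B i))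
... | B' , B'∈ℬ' , B'-lighter , B'A'-compat =
  A' ⊕ B' , (A' , B' , A'∈𝒜' , B'∈ℬ' , compatible⇒consistent A' B' Q A'B'-compat , λ _ → refl) ,
  lighter , A'B'-compat
  where
  A'B'-compat : Compatible r k (A' ⊕ B') Q
  A'B'-compat = compatible-congˡ (B' ⊕ A') (A' ⊕ B') Q B'A'-compat λ i → +-comm (B' i) (A' i)
  lighter : weight w (A' ⊕ B') ℤ.≤ weight w P
  lighter = ℤP.≤-trans (weight-⊕-mono w A'-lighter B'-lighter)
                       (ℤP.≤-reflexive (weight-resp w (λ i → sym (P≋A⊕B i))))
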